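{- Let $v=(v_1,\dots,v_d)$ be a finite sequence of nonnegative integers with $v_1+\dots+v_d=k>0$ and $v_1+2v_2+\dots+dv_d=n$. Let $\alpha(\ell,m)$ be a polynomial in $\ell$ and $m$ of total degree at most one (complex coefficients), with $\alpha(\ell,m)\neq 0$ for all integers $0\le\ell\le k$, $\ell\le m\le n$. Then for every $\tau\in\mathbb{C}$, \[ \sum_{\ell=0}^{k}\sum_{m=\ell}^n \frac{\alpha(k,n)}{\alpha(\ell,m)}\frac{\binom{\alpha(\ell,m)}{k-\ell}\binom{\tau-\alpha(\ell,m)}{\ell}}{\binom{k}{\ell}}W_{m,\ell}(v) =\binom{\tau}{k} \] and \[ \sum_{\ell=0}^{k}\sum_{m=\ell}^n \frac{\alpha(0,0)}{\alpha(\ell,m)}\frac{\binom{\tau-\alpha(\ell,m)}{k-\ell}\binom{\alpha(\ell,m)}{\ell}}{\binom{k}{\ell}}W_{m,\ell}(v) =\binom{\tau}{k}. \]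
   Context: For $v=(v_1,\dots,v_d)$ with nonnegative integer entries, $W_{m,\ell}(v)=\sum_{i\in\pi_d(m,\ell)}\binom{v_1}{i_1}\cdots\binom{v_d}{i_d}$, where $\pi_d(m,\ell)$ is the set of all $i=(i_1,\dots,i_d)\in\mathbb{N}_0^d$ with $i_1+\dots+i_d=\ell$ and $i_1+2i_2+\dots+di_d=m$; $W_{m,\ell}(v)=0$ if $\pi_d(m,\ell)$ is empty. Binomial coefficients $\binom{x}{j}=x(x-1)\cdots(x-j+1)/j!$ are the generalized ones for complex $x$ and integer $j\ge0$. -}

module Defs where

open import Level using (Level; _⊔_)
open import Algebra.Bundles using (CommutativeRing)
open import Data.Nat as ℕ using (ℕ; zero; suc; _∸_; _!)
open import Data.Nat.Combinatorics using (_C_)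
open import Data.Fin using (Fin; toℕ)
open import Data.Vec as Vec using (Vec; []; _∷_)
open import Data.List as List using (List; []; _∷_)
open import Data.Product using (_×_; _,_)
open import Data.Nat.ListAction using (sum; product)
open import Relation.Nullary using (¬_)
open import Relation.Nullary.Decidable using (_×-dec_)

boundedVecs : (d b : ℕ) → List (Vec ℕ d)
boundedVecs zero    b = [] ∷ []
boundedVecs (suc d) b =
  List.concatMap (λ x → List.map (x ∷_) (boundedVecs d b)) (List.upTo (suc b))

entrySum : ∀ {d} → Vec ℕ d → ℕ
entrySum i = sum (Vec.toList i)

weightedSum : ∀ {d} → Vec ℕ d → ℕ
weightedSum {d} i = sum (Vec.toList (Vec.zipWith ℕ._*_ (Vec.tabulate (λ (j : Fin d) → suc (toℕ j))) i))

-- π_d(m,ℓ) : all i ∈ ℕ₀^d with Σ i_j = ℓ and Σ j i_j = m.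
-- (Every such i has all entries ≤ ℓ, so it suffices to enumerate those.)
π : (d m ℓ : ℕ) → List (Vec ℕ d)
π d m ℓ = List.filter (λ i → (entrySum i ℕ.≟ ℓ) ×-dec (weightedSum i ℕ.≟ m)) (boundedVecs d ℓ)

W : (m ℓ : ℕ) → ∀ {d} → Vec ℕ d → ℕ
W m ℓ {d} v = sum (List.map (λ i → product (Vec.toList (Vec.zipWith _C_ v i))) (π d m ℓ))

-- Fields of characteristic zero, presented as a commutative ring with an
-- inverse map that is a genuine inverse on nonzero elements (its value at
-- 0 is irrelevant junk), and with n·1 ≠ 0 for all n ≥ 1.

module _ {c ℓ : Level} (R : CommutativeRing c ℓ) where
  open CommutativeRing R

  ι : ℕ → Carrier
  ι zero    = 0#
  ι (suc n) = 1# + ι n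

  record IsCharZeroField : Set (c ⊔ ℓ) where
    field
      _⁻¹       : Carrier → Carrier
      ⁻¹-inverse : ∀ x → ¬ (x ≈ 0#) → x * (x ⁻¹) ≈ 1#
      charZero  : ∀ n → ¬ (ι (suc n) ≈ 0#)

  module FieldOps (F : IsCharZeroField) where
    open IsCharZeroField F public

    infixl 7 _/_
    _/_ : Carrier → Carrier → Carrier
    x / y = x * (y ⁻¹)

    falling : Carrier → ℕ → Carrier
    falling x zero    = 1#
    falling x (suc j) = falling x j * (x - ι j)

    binom : Carrier → ℕ → Carrier
    binom x j = falling x j / ι (j !)

    -- Σ_{ℓ = lo}^{hi} f ℓ   (empty, i.e. 0, when hi < lo)
    sumFromTo : ℕ → ℕ → (ℕ → Carrier) → Carrier
    sumFromTo lo hi f =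
      List.foldr (λ x acc → f x + acc) 0# (List.map (lo ℕ.+_) (List.upTo (suc hi ∸ lo)))

-- Let P be the list of parts of v (vⱼ parts equal to j): it has k entries summing to n, and
-- W_{m,ℓ}(v) counts the sub-multisets of P with ℓ parts summing to m.  Hence each double sum is a
-- sum over the splittings P = S ⊔ T, and α(|S|, ΣS) = a₀ + Σ_{s∈S} h(s) with h(s) = a₁ + a₂ s.
-- Writing (z)ⱼ for the falling factorial, after clearing factorials both identities become
-- Hurwitz's falling-factorial form of Abel's identity
--   (x + y + Σ_E h)_{|E|} = Σ_{E = S ⊔ T} x / (x + Σ_S h) · (x + Σ_S h)_{|S|} · (y + Σ_T h)_{|T|},
-- the second with x = a₀ and y = τ − α(k,n), the first with weights −h, x = α(k,n), y = τ − a₀ and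
-- the roles of S and T exchanged.  Hurwitz's identity follows by induction on E, the step resting
-- on the fact that Σ_{E = S ⊔ T} (x + Σ_S h)_{|S|} (y + Σ_T h)_{|T|} depends only on x + y.
module Submission where

open import Level using (Level)
open import Function using (_∘_)
open import Data.Empty using (⊥-elim)
open import Data.Bool using (Bool; true; false; _∧_)
open import Data.Product using (_×_; _,_)
open import Data.Maybe using (Maybe; just; nothing)
open import Data.Nat as ℕ using (ℕ; zero; suc; z≤n; s≤s; _∸_; _!)
import Data.Nat.Properties as ℕ
open import Data.Nat.Combinatorics
  using (_C_; k>n⇒nCk≡0; nCk+nC[k+1]≡[n+1]C[k+1]; nCk≡n!/k![n-k]!; k![n∸k]!∣n!)
open import Data.Nat.DivMod using (m/n*n≡m)
open import Data.Nat.ListAction using (sum; product)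
open import Data.Nat.ListAction.Properties using (sum-++)
open import Data.Nat.Tactic.RingSolver using (solve-∀)
open import Data.Integer as ℤ using (ℤ; +_; -[1+_])
import Data.Integer.Properties as ℤ
open import Data.Fin as Fin using (Fin; toℕ)
open import Data.List as List using (List; []; _∷_; length; map; replicate; _++_)
import Data.List.Properties as List
open import Data.List.Relation.Unary.All as All using (All; []; _∷_)
import Data.List.Relation.Unary.All.Properties as All
open import Data.List.Relation.Ternary.Interleaving.Propositional
  using (Interleaving; []; consˡ; consʳ) renaming (swap to interleaving-swap)
open import Data.List.Relation.Ternary.Interleaving.Properties using (interleave-length)
open import Data.Vec as Vec using (Vec; []; _∷_)
open import Data.Vec.Relation.Unary.All as VecAll using ([]; _∷_) renaming (All to VecAll)
open import Data.Vec.Relation.Binary.Pointwise.Inductive as Pointwise using (Pointwise; []; _∷_)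
open import Algebra.Bundles using (CommutativeRing)
open import Relation.Binary.PropositionalEquality as ≡ using (_≡_)
open import Relation.Nullary using (¬_; Dec; yes; no; does)
open import Relation.Nullary.Decidable using (dec-false; _×-dec_)
open import Relation.Unary using (Pred; Decidable)

open import Defs

-- `fromℤ (+ 1)` is `1# + 0#`, not `1#`: the proofs below therefore hand `1#` to `solve` as a variable.
module IntegerCoefficientSolver {c ℓ : Level} (R : CommutativeRing c ℓ) where
  open CommutativeRing R
  open import Relation.Binary.Reasoning.Setoid setoid
  open import Algebra.Properties.Ring ring
    using (-‿distribˡ-*; -‿distribʳ-*; -‿involutive; -0#≈0#; -‿+-comm)
  open import Algebra.Solver.Ring.AlmostCommutativeRing
    using (fromCommutativeRing; _-Raw-AlmostCommutative⟶_)

  ι-homo-+ : ∀ m n → ι R (m ℕ.+ n) ≈ ι R m + ι R n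
  ι-homo-+ zero    n = sym (+-identityˡ _)
  ι-homo-+ (suc m) n = trans (+-congˡ (ι-homo-+ m n)) (sym (+-assoc _ _ _))

  ι-homo-* : ∀ m n → ι R (m ℕ.* n) ≈ ι R m * ι R n
  ι-homo-* zero    n = sym (zeroˡ _)
  ι-homo-* (suc m) n = begin
    ι R (n ℕ.+ m ℕ.* n)            ≈⟨ ι-homo-+ n (m ℕ.* n) ⟩
    ι R n + ι R (m ℕ.* n)          ≈⟨ +-cong (sym (*-identityˡ _)) (ι-homo-* m n) ⟩
    1# * ι R n + ι R m * ι R n     ≈⟨ distribʳ _ _ _ ⟨
    (1# + ι R m) * ι R n           ∎

  private
    fromℤ : ℤ → Carrier
    fromℤ (+ n)      = ι R n
    fromℤ -[1+ n ]   = - ι R (suc n)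

    fromℤ-homo-⊖ : ∀ m n → fromℤ (m ℤ.⊖ n) ≈ ι R m - ι R n
    fromℤ-homo-⊖ zero    zero    = sym (-‿inverseʳ 0#)
    fromℤ-homo-⊖ zero    (suc n) = sym (+-identityˡ _)
    fromℤ-homo-⊖ (suc m) zero    = trans (sym (+-identityʳ _)) (+-congˡ (sym -0#≈0#))
    fromℤ-homo-⊖ (suc m) (suc n) = begin
      fromℤ (suc m ℤ.⊖ suc n)               ≡⟨ ≡.cong fromℤ (ℤ.[1+m]⊖[1+n]≡m⊖n m n) ⟩
      fromℤ (m ℤ.⊖ n)                       ≈⟨ fromℤ-homo-⊖ m n ⟩
      ι R m - ι R n                     ≈⟨ +-congʳ (+-identityˡ _) ⟨
      (0# + ι R m) - ι R n              ≈⟨ +-congʳ (+-congʳ (-‿inverseʳ 1#)) ⟨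
      ((1# - 1#) + ι R m) - ι R n       ≈⟨ regroup 1# (ι R m) (ι R n) ⟩
      (1# + ι R m) + (- 1# - ι R n)     ≈⟨ +-congˡ (-‿+-comm 1# (ι R n)) ⟩
      (1# + ι R m) - (1# + ι R n)       ∎
      where
      regroup : ∀ a b c → ((a - a) + b) - c ≈ (a + b) + (- a - c)
      regroup a b c = begin
        ((a - a) + b) - c     ≈⟨ +-congʳ (+-assoc _ _ _) ⟩
        (a + (- a + b)) - c   ≈⟨ +-congʳ (+-congˡ (+-comm _ _)) ⟩
        (a + (b - a)) - c     ≈⟨ +-congʳ (+-assoc _ _ _) ⟨
        ((a + b) - a) - c     ≈⟨ +-assoc _ _ _ ⟩
        (a + b) + (- a - c)   ∎

    fromℤ-homo-- : ∀ i → fromℤ (ℤ.- i) ≈ - fromℤ i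
    fromℤ-homo-- -[1+ n ]    = sym (-‿involutive _)
    fromℤ-homo-- (+ zero)    = sym -0#≈0#
    fromℤ-homo-- (+ suc n)   = refl

    fromℤ-homo-+ : ∀ i j → fromℤ (i ℤ.+ j) ≈ fromℤ i + fromℤ j
    fromℤ-homo-+ -[1+ m ] -[1+ n ] = begin
      - (1# + ι R (suc (m ℕ.+ n)))    ≈⟨ -‿cong (+-congˡ (ι-homo-+ (suc m) n)) ⟩
      - (1# + (ι R (suc m) + ι R n))  ≈⟨ -‿cong (+-assoc _ _ _) ⟨
      - (1# + ι R (suc m) + ι R n)    ≈⟨ -‿cong (+-congʳ (+-comm _ _)) ⟩
      - (ι R (suc m) + 1# + ι R n)    ≈⟨ -‿cong (+-assoc _ _ _) ⟩
      - (ι R (suc m) + ι R (suc n))   ≈⟨ -‿+-comm _ _ ⟨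
      - ι R (suc m) - ι R (suc n)     ∎
    fromℤ-homo-+ -[1+ m ] (+ n)    = trans (fromℤ-homo-⊖ n (suc m)) (+-comm _ _)
    fromℤ-homo-+ (+ m)    -[1+ n ] = fromℤ-homo-⊖ m (suc n)
    fromℤ-homo-+ (+ m)    (+ n)    = ι-homo-+ m n

    fromℤ-homo-*-+ : ∀ m j → fromℤ (+ m ℤ.* j) ≈ ι R m * fromℤ j
    fromℤ-homo-*-+ m (+ n)    = trans (reflexive (≡.cong fromℤ (≡.sym (ℤ.pos-* m n)))) (ι-homo-* m n)
    fromℤ-homo-*-+ m -[1+ n ] = begin
      fromℤ (+ m ℤ.* -[1+ n ])        ≡⟨ ≡.cong fromℤ (ℤ.neg-distribʳ-* (+ m) (+ suc n)) ⟨
      fromℤ (ℤ.- (+ m ℤ.* + suc n))   ≈⟨ fromℤ-homo-- (+ m ℤ.* + suc n) ⟩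
      - fromℤ (+ m ℤ.* + suc n)       ≈⟨ -‿cong (fromℤ-homo-*-+ m (+ suc n)) ⟩
      - (ι R m * ι R (suc n))         ≈⟨ -‿distribʳ-* _ _ ⟩
      ι R m * - ι R (suc n)           ∎

    fromℤ-homo-* : ∀ i j → fromℤ (i ℤ.* j) ≈ fromℤ i * fromℤ j
    fromℤ-homo-* (+ m)    j = fromℤ-homo-*-+ m j
    fromℤ-homo-* -[1+ m ] j = begin
      fromℤ (-[1+ m ] ℤ.* j)          ≡⟨ ≡.cong fromℤ (ℤ.neg-distribˡ-* (+ suc m) j) ⟨
      fromℤ (ℤ.- (+ suc m ℤ.* j))     ≈⟨ fromℤ-homo-- (+ suc m ℤ.* j) ⟩
      - fromℤ (+ suc m ℤ.* j)         ≈⟨ -‿cong (fromℤ-homo-*-+ (suc m) j) ⟩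
      - (ι R (suc m) * fromℤ j)       ≈⟨ -‿distribˡ-* _ _ ⟩
      - ι R (suc m) * fromℤ j         ∎

    ℤ⟶R : ℤ.+-*-rawRing -Raw-AlmostCommutative⟶ fromCommutativeRing R
    ℤ⟶R = record
      { ⟦_⟧ = fromℤ ; +-homo = fromℤ-homo-+ ; *-homo = fromℤ-homo-* ; -‿homo = fromℤ-homo--
      ; 0-homo = refl ; 1-homo = +-identityʳ 1# }

    fromℤ-≟ : (i j : ℤ) → Maybe (fromℤ i ≈ fromℤ j)
    fromℤ-≟ i j with i ℤ.≟ j
    ... | yes ≡.refl = just refl
    ... | no _       = nothing

  open import Algebra.Solver.Ring ℤ.+-*-rawRing (fromCommutativeRing R) ℤ⟶R fromℤ-≟ public

dot : ∀ {d} → Vec ℕ d → Vec ℕ d → ℕ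
dot w i = sum (Vec.toList (Vec.zipWith ℕ._*_ w i))

dot-tabulate-suc : ∀ {d} (f : Fin d → ℕ) (i : Vec ℕ d) →
  dot (Vec.tabulate (suc ∘ f)) i ≡ dot (Vec.tabulate f) i ℕ.+ entrySum i
dot-tabulate-suc f []      = ≡.refl
dot-tabulate-suc f (x ∷ i) = ≡.trans
  (≡.cong (x ℕ.+ f Fin.zero ℕ.* x ℕ.+_) (dot-tabulate-suc (f ∘ Fin.suc) i))
  (regroup x (f Fin.zero ℕ.* x) (dot (Vec.tabulate (f ∘ Fin.suc)) i) (entrySum i))
  where
  regroup : ∀ x y w e → x ℕ.+ y ℕ.+ (w ℕ.+ e) ≡ y ℕ.+ w ℕ.+ (x ℕ.+ e)
  regroup = solve-∀

weightedSum-∷ : ∀ {d} x (i : Vec ℕ d) → weightedSum (x ∷ i) ≡ x ℕ.+ (weightedSum i ℕ.+ entrySum i)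
weightedSum-∷ x i = ≡.cong₂ ℕ._+_ (ℕ.+-identityʳ x) (dot-tabulate-suc (suc ∘ toℕ) i)

dot-monoʳ-≤ : ∀ {d} (w : Vec ℕ d) {i j : Vec ℕ d} → Pointwise ℕ._≤_ i j → dot w i ℕ.≤ dot w j
dot-monoʳ-≤ []      []       = z≤n
dot-monoʳ-≤ (c ∷ w) (p ∷ ps) = ℕ.+-mono-≤ (ℕ.*-monoʳ-≤ c p) (dot-monoʳ-≤ w ps)

weightedSum-mono-≤ : ∀ {d} {i j : Vec ℕ d} → Pointwise ℕ._≤_ i j → weightedSum i ℕ.≤ weightedSum j
weightedSum-mono-≤ = dot-monoʳ-≤ (Vec.tabulate (suc ∘ toℕ))

entrySum-mono-≤ : ∀ {d} {i j : Vec ℕ d} → Pointwise ℕ._≤_ i j → entrySum i ℕ.≤ entrySum j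
entrySum-mono-≤ []       = z≤n
entrySum-mono-≤ (p ∷ ps) = ℕ.+-mono-≤ p (entrySum-mono-≤ ps)

entrySum≤weightedSum : ∀ {d} (i : Vec ℕ d) → entrySum i ℕ.≤ weightedSum i
entrySum≤weightedSum []      = z≤n
entrySum≤weightedSum (x ∷ i) =
  ≡.subst (entrySum (x ∷ i) ℕ.≤_) (≡.sym (weightedSum-∷ x i))
    (ℕ.+-monoʳ-≤ x (ℕ.m≤n+m (entrySum i) (weightedSum i)))

entries≤entrySum : ∀ {d} (i : Vec ℕ d) → VecAll (ℕ._≤ entrySum i) i
entries≤entrySum []      = []
entries≤entrySum (x ∷ i) = ℕ.m≤m+n x (entrySum i)
  ∷ VecAll.map (λ y≤ → ℕ.≤-trans y≤ (ℕ.m≤n+m (entrySum i) x)) (entries≤entrySum i)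

∏C : ∀ {d} → Vec ℕ d → Vec ℕ d → ℕ
∏C v i = product (Vec.toList (Vec.zipWith _C_ v i))

∏C-≰ : ∀ {d} (v i : Vec ℕ d) → ¬ Pointwise ℕ._≤_ i v → ∏C v i ≡ 0
∏C-≰ []      []      i≰v = ⊥-elim (i≰v [])
∏C-≰ (y ∷ v) (x ∷ i) i≰v with x ℕ.≤? y
... | yes x≤y = ≡.trans (≡.cong ((y C x) ℕ.*_) (∏C-≰ v i (i≰v ∘ (x≤y ∷_)))) (ℕ.*-zeroʳ (y C x))
... | no  x≰y = ≡.cong (ℕ._* ∏C v i) (k>n⇒nCk≡0 (ℕ.≰⇒> x≰y))

C*factorials≡! : ∀ {n k} → k ℕ.≤ n → (n C k) ℕ.* (k ! ℕ.* (n ∸ k) !) ≡ n !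
C*factorials≡! {n} {k} k≤n = ≡.trans (≡.cong (ℕ._* (k ! ℕ.* (n ∸ k) !)) (nCk≡n!/k![n-k]! k≤n))
  (m/n*n≡m {{ℕ._!*_!≢0 k (n ∸ k)}} (k![n∸k]!∣n! k≤n))

consParts : ℕ → List ℕ → List ℕ
consParts x S = replicate x 1 ++ map suc S

-- The multiset with vⱼ parts equal to j, i.e. the partition of weightedSum v with multiplicities v.
parts : ∀ {d} → Vec ℕ d → List ℕ
parts []      = []
parts (x ∷ v) = consParts x (parts v)

length-consParts : ∀ x S → length (consParts x S) ≡ x ℕ.+ length S
length-consParts x S = ≡.trans (List.length-++ (replicate x 1))
  (≡.cong₂ ℕ._+_ (List.length-replicate x) (List.length-map suc S))

sum-consParts : ∀ x S → sum (consParts x S) ≡ x ℕ.+ (sum S ℕ.+ length S)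
sum-consParts x S = ≡.trans (sum-++ (replicate x 1) (map suc S))
  (≡.cong₂ ℕ._+_ (sum-replicate-1 x) (sum-map-suc S))
  where
  sum-replicate-1 : ∀ n → sum (replicate n 1) ≡ n
  sum-replicate-1 zero    = ≡.refl
  sum-replicate-1 (suc n) = ≡.cong suc (sum-replicate-1 n)
  sum-map-suc : ∀ S → sum (map suc S) ≡ sum S ℕ.+ length S
  sum-map-suc []      = ≡.refl
  sum-map-suc (s ∷ S) = ≡.trans (≡.cong (suc s ℕ.+_) (sum-map-suc S)) (regroup s (sum S) (length S))
    where
    regroup : ∀ s a b → suc s ℕ.+ (a ℕ.+ b) ≡ (s ℕ.+ a) ℕ.+ suc b
    regroup = solve-∀

length-parts : ∀ {d} (v : Vec ℕ d) → length (parts v) ≡ entrySum v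
length-parts []      = ≡.refl
length-parts (x ∷ v) = ≡.trans (length-consParts x (parts v)) (≡.cong (x ℕ.+_) (length-parts v))

sum-parts : ∀ {d} (v : Vec ℕ d) → sum (parts v) ≡ weightedSum v
sum-parts []      = ≡.refl
sum-parts (x ∷ v) = begin
  sum (consParts x (parts v))                     ≡⟨ sum-consParts x (parts v) ⟩
  x ℕ.+ (sum (parts v) ℕ.+ length (parts v))
    ≡⟨ ≡.cong₂ (λ a b → x ℕ.+ (a ℕ.+ b)) (sum-parts v) (length-parts v) ⟩
  x ℕ.+ (weightedSum v ℕ.+ entrySum v)            ≡⟨ weightedSum-∷ x v ⟨
  weightedSum (x ∷ v)                             ∎
  where open ≡.≡-Reasoning

parts-positive : ∀ {d} (v : Vec ℕ d) → All (1 ℕ.≤_) (parts v)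
parts-positive []      = []
parts-positive (x ∷ v) =
  All.++⁺ (All.replicate⁺ x (s≤s z≤n)) (All.map⁺ (All.universal (λ _ → s≤s z≤n) (parts v)))

length≤sum : ∀ {S} → All (1 ℕ.≤_) S → length S ℕ.≤ sum S
length≤sum []       = z≤n
length≤sum (p ∷ ps) = ℕ.+-mono-≤ p (length≤sum ps)

module _ {a} {X : Set a} where

  All-interleavingˡ : ∀ {p} {P : X → Set p} {S T E} → Interleaving S T E → All P E → All P S
  All-interleavingˡ []          []       = []
  All-interleavingˡ (consˡ sp) (p ∷ ps) = p ∷ All-interleavingˡ sp ps
  All-interleavingˡ (consʳ sp) (p ∷ ps) = All-interleavingˡ sp ps

  length-interleavingˡ : ∀ {S T E : List X} → Interleaving S T E → length S ℕ.≤ length E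
  length-interleavingˡ {S} {T} sp = ≡.subst (length S ℕ.≤_) (≡.sym (interleave-length sp)) (ℕ.m≤m+n _ _)

  length-interleavingʳ : ∀ {S T E : List X} → Interleaving S T E → length T ℕ.≤ length E
  length-interleavingʳ {S} {T} sp = ≡.subst (length T ℕ.≤_) (≡.sym (interleave-length sp)) (ℕ.m≤n+m _ _)

sum-interleaving : ∀ {S T E : List ℕ} → Interleaving S T E → sum S ℕ.+ sum T ≡ sum E
sum-interleaving []                                  = ≡.refl
sum-interleaving {x ∷ S} {T}     {_ ∷ E} (consˡ sp) =
  ≡.trans (ℕ.+-assoc x (sum S) (sum T)) (≡.cong (x ℕ.+_) (sum-interleaving sp))
sum-interleaving {S}     {x ∷ T} {_ ∷ E} (consʳ sp) =
  ≡.trans (regroup (sum S) x (sum T)) (≡.cong (x ℕ.+_) (sum-interleaving sp))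
  where
  regroup : ∀ s x t → s ℕ.+ (x ℕ.+ t) ≡ x ℕ.+ (s ℕ.+ t)
  regroup = solve-∀

module _ {d} (v : Vec ℕ d) {S T : List ℕ} (sp : Interleaving S T (parts v)) where

  sublist-length≤entrySum : length S ℕ.≤ entrySum v
  sublist-length≤entrySum = ≡.subst (length S ℕ.≤_) (length-parts v) (length-interleavingˡ sp)

  sublist-length≤sum : length S ℕ.≤ sum S
  sublist-length≤sum = length≤sum (All-interleavingˡ sp (parts-positive v))

  sublist-sum≤weightedSum : sum S ℕ.≤ weightedSum v
  sublist-sum≤weightedSum =
    ≡.subst (sum S ℕ.≤_) (≡.trans (sum-interleaving sp) (sum-parts v)) (ℕ.m≤m+n (sum S) (sum T))

  complement-length : length T ≡ entrySum v ∸ length S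
  complement-length = ≡.trans (≡.sym (ℕ.m+n∸m≡n (length S) (length T)))
    (≡.cong (ℕ._∸ length S) (≡.trans (≡.sym (interleave-length sp)) (length-parts v)))

module ListSums {c ℓ : Level} (R : CommutativeRing c ℓ) where
  open CommutativeRing R
  open import Relation.Binary.Reasoning.Setoid setoid
  open IntegerCoefficientSolver R using (solve; _:+_; _:=_; ι-homo-+)
  open import Algebra.Properties.Ring ring using (-0#≈0#; -‿+-comm)

  private variable
    a b : Level
    X : Set a
    Y : Set b

  ∑ : List X → (X → Carrier) → Carrier
  ∑ L f = List.foldr (λ x acc → f x + acc) 0# L

  ∑-cong : ∀ (L : List X) {f g : X → Carrier} → (∀ x → f x ≈ g x) → ∑ L f ≈ ∑ L g
  ∑-cong []      f≈g = refl
  ∑-cong (x ∷ L) f≈g = +-cong (f≈g x) (∑-cong L f≈g)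

  ∑-zero : ∀ (L : List X) {f : X → Carrier} → (∀ x → f x ≈ 0#) → ∑ L f ≈ 0#
  ∑-zero []      f≈0 = refl
  ∑-zero (x ∷ L) f≈0 = trans (+-cong (f≈0 x) (∑-zero L f≈0)) (+-identityˡ 0#)

  ∑-++ : ∀ (A B : List X) (f : X → Carrier) → ∑ (A ++ B) f ≈ ∑ A f + ∑ B f
  ∑-++ []      B f = sym (+-identityˡ _)
  ∑-++ (x ∷ A) B f = trans (+-congˡ (∑-++ A B f)) (sym (+-assoc _ _ _))

  ∑-+ : ∀ (L : List X) (f g : X → Carrier) → ∑ L (λ x → f x + g x) ≈ ∑ L f + ∑ L g
  ∑-+ []      f g = sym (+-identityˡ 0#)
  ∑-+ (x ∷ L) f g = trans (+-congˡ (∑-+ L f g)) (interchange _ _ _ _)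
    where
    interchange : ∀ a b c d → (a + b) + (c + d) ≈ (a + c) + (b + d)
    interchange = solve 4 (λ a b c d → (a :+ b) :+ (c :+ d) := (a :+ c) :+ (b :+ d)) refl

  ∑-*ˡ : ∀ (L : List X) (k : Carrier) (f : X → Carrier) → ∑ L (λ x → k * f x) ≈ k * ∑ L f
  ∑-*ˡ []      k f = sym (zeroʳ k)
  ∑-*ˡ (x ∷ L) k f = trans (+-congˡ (∑-*ˡ L k f)) (sym (distribˡ _ _ _))

  ∑-neg : ∀ (L : List X) (f : X → Carrier) → ∑ L (λ x → - f x) ≈ - ∑ L f
  ∑-neg []      f = sym -0#≈0#
  ∑-neg (x ∷ L) f = trans (+-congˡ (∑-neg L f)) (-‿+-comm _ _)

  ∑-map : (g : Y → X) (L : List Y) (f : X → Carrier) → ∑ (map g L) f ≡ ∑ L (f ∘ g)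
  ∑-map g []      f = ≡.refl
  ∑-map g (y ∷ L) f = ≡.cong (_+_ (f (g y))) (∑-map g L f)

  ∑-concatMap : (g : Y → List X) (L : List Y) (f : X → Carrier) →
    ∑ (List.concatMap g L) f ≈ ∑ L (λ y → ∑ (g y) f)
  ∑-concatMap g []      f = refl
  ∑-concatMap g (y ∷ L) f = trans (∑-++ (g y) (List.concatMap g L) f) (+-congˡ (∑-concatMap g L f))

  ∑-comm : (L : List X) (M : List Y) (f : X → Y → Carrier) →
    ∑ L (λ x → ∑ M (f x)) ≈ ∑ M (λ y → ∑ L (λ x → f x y))
  ∑-comm []      M f = sym (∑-zero M (λ _ → refl))
  ∑-comm (x ∷ L) M f = trans (+-congˡ (∑-comm L M f)) (sym (∑-+ M _ _))

  𝟙 : Bool → Carrier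
  𝟙 true  = 1#
  𝟙 false = 0#

  𝟙-∧ : ∀ a b → 𝟙 (a ∧ b) ≈ 𝟙 a * 𝟙 b
  𝟙-∧ true  b = sym (*-identityˡ _)
  𝟙-∧ false b = sym (zeroˡ _)

  ι-sum-filter : ∀ {p} {P : Pred X p} (P? : Decidable P) (h : X → ℕ) (L : List X) →
    ι R (sum (map h (List.filter P? L))) ≈ ∑ L (λ x → 𝟙 (does (P? x)) * ι R (h x))
  ι-sum-filter P? h []      = refl
  ι-sum-filter P? h (x ∷ L) with does (P? x)
  ... | true  = trans (ι-homo-+ (h x) _) (+-cong (sym (*-identityˡ _)) (ι-sum-filter P? h L))
  ... | false = trans (ι-sum-filter P? h L) (trans (sym (+-identityˡ _)) (+-congʳ (sym (zeroˡ _))))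

  ∑< : ℕ → (ℕ → Carrier) → Carrier
  ∑< zero    f = 0#
  ∑< (suc n) f = f 0 + ∑< n (f ∘ suc)

  ∑-upTo : ∀ n (f : ℕ → Carrier) → ∑ (List.upTo n) f ≡ ∑< n f
  ∑-upTo n f = ∑-applyUpTo (λ i → i) n f
    where
    ∑-applyUpTo : ∀ (g : ℕ → ℕ) n f → ∑ (List.applyUpTo g n) f ≡ ∑< n (f ∘ g)
    ∑-applyUpTo g zero    f = ≡.refl
    ∑-applyUpTo g (suc n) f = ≡.cong (_+_ (f (g 0))) (∑-applyUpTo (g ∘ suc) n f)

  ∑<-cong : ∀ n {f g} → (∀ i → i ℕ.< n → f i ≈ g i) → ∑< n f ≈ ∑< n g
  ∑<-cong zero    f≈g = refl
  ∑<-cong (suc n) f≈g = +-cong (f≈g 0 (s≤s z≤n)) (∑<-cong n (λ i i<n → f≈g (suc i) (s≤s i<n)))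

  ∑<-zero : ∀ n {f} → (∀ i → f i ≈ 0#) → ∑< n f ≈ 0#
  ∑<-zero zero    f≈0 = refl
  ∑<-zero (suc n) f≈0 = trans (+-cong (f≈0 0) (∑<-zero n (f≈0 ∘ suc))) (+-identityˡ 0#)

  ∑<-+ : ∀ n (f g : ℕ → Carrier) → ∑< n (λ i → f i + g i) ≈ ∑< n f + ∑< n g
  ∑<-+ zero    f g = sym (+-identityˡ 0#)
  ∑<-+ (suc n) f g = trans (+-congˡ (∑<-+ n (f ∘ suc) (g ∘ suc)))
    (solve 4 (λ a b c d → (a :+ b) :+ (c :+ d) := (a :+ c) :+ (b :+ d)) refl _ _ _ _)

  ∑<-suc : ∀ n (f : ℕ → Carrier) → ∑< (suc n) f ≈ ∑< n f + f n
  ∑<-suc zero    f = trans (+-identityʳ _) (sym (+-identityˡ _))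
  ∑<-suc (suc n) f = trans (+-congˡ (∑<-suc n (f ∘ suc))) (sym (+-assoc _ _ _))

  ∑<-truncate : ∀ l K f → l ℕ.≤ K → (∀ x → l ℕ.< x → f x ≈ 0#) → ∑< (suc K) f ≈ ∑< (suc l) f
  ∑<-truncate zero    K       f l≤K f≈0 = +-congˡ (∑<-zero K (λ i → f≈0 (suc i) (s≤s z≤n)))
  ∑<-truncate (suc l) (suc K) f (s≤s l≤K) f≈0 =
    +-congˡ (∑<-truncate l K (f ∘ suc) l≤K (λ x l<x → f≈0 (suc x) (s≤s l<x)))

  ∑<-δ : ∀ n j (f : ℕ → Carrier) → j ℕ.< n → ∑< n (λ i → 𝟙 (does (j ℕ.≟ i)) * f i) ≈ f j
  ∑<-δ (suc n) zero    f j<n = trans (+-cong (*-identityˡ _)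
    (∑<-zero n (λ i → zeroˡ _))) (+-identityʳ _)
  ∑<-δ (suc n) (suc j) f (s≤s j<n) = trans (+-cong (zeroˡ _)
    (∑<-δ n j (f ∘ suc) j<n)) (+-identityˡ _)

  -- Definitionally equal to `sumFromTo` of Defs, which is only available over a field.
  ∑range : ℕ → ℕ → (ℕ → Carrier) → Carrier
  ∑range lo hi f = ∑ (map (lo ℕ.+_) (List.upTo (suc hi ∸ lo))) f

  ∑range≡∑< : ∀ lo hi f → ∑range lo hi f ≡ ∑< (suc hi ∸ lo) (λ t → f (lo ℕ.+ t))
  ∑range≡∑< lo hi f = ≡.trans (∑-map (lo ℕ.+_) (List.upTo (suc hi ∸ lo)) f) (∑-upTo (suc hi ∸ lo) _)

  ∑range-cong : ∀ lo hi {f g : ℕ → Carrier} → (∀ j → lo ℕ.≤ j → j ℕ.≤ hi → f j ≈ g j) →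
    ∑range lo hi f ≈ ∑range lo hi g
  ∑range-cong lo hi {f} {g} f≈g = begin
    ∑range lo hi f
      ≡⟨ ∑range≡∑< lo hi f ⟩
    ∑< (suc hi ∸ lo) (λ t → f (lo ℕ.+ t))
      ≈⟨ ∑<-cong (suc hi ∸ lo) (λ t t< → f≈g (lo ℕ.+ t) (ℕ.m≤m+n lo t) (in-range lo hi t t<)) ⟩
    ∑< (suc hi ∸ lo) (λ t → g (lo ℕ.+ t))
      ≡⟨ ∑range≡∑< lo hi g ⟨
    ∑range lo hi g ∎
    where
    in-range : ∀ lo hi t → t ℕ.< suc hi ∸ lo → lo ℕ.+ t ℕ.≤ hi
    in-range zero     hi       t (s≤s t≤hi) = t≤hi
    in-range (suc lo) zero     t t<         = ⊥-elim (ℕ.n≮0 (≡.subst (t ℕ.<_) (ℕ.0∸n≡0 lo) t<))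
    in-range (suc lo) (suc hi) t t<         = s≤s (in-range lo hi t t<)

  ∑range-comm : ∀ {a} {X : Set a} lo hi (L : List X) (f : ℕ → X → Carrier) →
    ∑range lo hi (λ l → ∑ L (f l)) ≈ ∑ L (λ x → ∑range lo hi (λ l → f l x))
  ∑range-comm lo hi = ∑-comm (map (lo ℕ.+_) (List.upTo (suc hi ∸ lo)))

  ∑range-*ˡ : ∀ lo hi k (f : ℕ → Carrier) → ∑range lo hi (λ l → k * f l) ≈ k * ∑range lo hi f
  ∑range-*ˡ lo hi = ∑-*ˡ (map (lo ℕ.+_) (List.upTo (suc hi ∸ lo)))

  ∑range-δ : ∀ lo hi j (f : ℕ → Carrier) → lo ℕ.≤ j → j ℕ.≤ hi →
    ∑range lo hi (λ l → 𝟙 (does (j ℕ.≟ l)) * f l) ≈ f j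
  ∑range-δ lo hi j f lo≤j j≤hi = begin
    ∑range lo hi (λ l → 𝟙 (does (j ℕ.≟ l)) * f l)
      ≡⟨ ∑range≡∑< lo hi _ ⟩
    ∑< (suc hi ∸ lo) (λ t → 𝟙 (does (j ℕ.≟ lo ℕ.+ t)) * f (lo ℕ.+ t))
      ≡⟨ ≡.cong (λ x → ∑< (suc hi ∸ lo) (λ t → 𝟙 (does (x ℕ.≟ lo ℕ.+ t)) * f (lo ℕ.+ t)))
                lo+[j∸lo]≡j ⟨
    ∑< (suc hi ∸ lo) (λ t → 𝟙 (does (lo ℕ.+ (j ∸ lo) ℕ.≟ lo ℕ.+ t)) * f (lo ℕ.+ t))
      ≈⟨ ∑<-cong (suc hi ∸ lo) (λ t _ → *-congʳ (reflexive (≡.cong 𝟙 (does-≟-+ˡ lo (j ∸ lo) t)))) ⟩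
    ∑< (suc hi ∸ lo) (λ t → 𝟙 (does (j ∸ lo ℕ.≟ t)) * f (lo ℕ.+ t))
      ≈⟨ ∑<-δ (suc hi ∸ lo) (j ∸ lo) (λ t → f (lo ℕ.+ t)) (ℕ.∸-monoˡ-< (s≤s j≤hi) lo≤j) ⟩
    f (lo ℕ.+ (j ∸ lo))
      ≡⟨ ≡.cong f lo+[j∸lo]≡j ⟩
    f j ∎
    where
    lo+[j∸lo]≡j : lo ℕ.+ (j ∸ lo) ≡ j
    lo+[j∸lo]≡j = ℕ.m+[n∸m]≡n lo≤j
    does-≟-+ˡ : ∀ lo a b → does (lo ℕ.+ a ℕ.≟ lo ℕ.+ b) ≡ does (a ℕ.≟ b)
    does-≟-+ˡ zero     a b = ≡.refl
    does-≟-+ˡ (suc lo) a b = does-≟-+ˡ lo a b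

module Splittings {c ℓ : Level} (R : CommutativeRing c ℓ) where
  open CommutativeRing R
  open import Relation.Binary.Reasoning.Setoid setoid
  open IntegerCoefficientSolver R using (solve; _:+_; _:=_)
  open ListSums R

  private variable
    a : Level
    X : Set a

  ∑split : List X → (List X → List X → Carrier) → Carrier
  ∑split []      F = F [] []
  ∑split (x ∷ E) F = ∑split E (λ S T → F (x ∷ S) T) + ∑split E (λ S T → F S (x ∷ T))

  ∑split₃ : List X → (List X → List X → List X → Carrier) → Carrier
  ∑split₃ []      G = G [] [] []
  ∑split₃ (x ∷ E) G = ∑split₃ E (λ U V W → G (x ∷ U) V W)
                    + (∑split₃ E (λ U V W → G U (x ∷ V) W) + ∑split₃ E (λ U V W → G U V (x ∷ W)))

  ∑split-congᴵ : ∀ (E : List X) {F G} → (∀ S T → Interleaving S T E → F S T ≈ G S T) →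
    ∑split E F ≈ ∑split E G
  ∑split-congᴵ []      F≈G = F≈G [] [] []
  ∑split-congᴵ (x ∷ E) F≈G = +-cong (∑split-congᴵ E (λ S T sp → F≈G (x ∷ S) T (consˡ sp)))
                                    (∑split-congᴵ E (λ S T sp → F≈G S (x ∷ T) (consʳ sp)))

  ∑split-cong : ∀ (E : List X) {F G} → (∀ S T → F S T ≈ G S T) → ∑split E F ≈ ∑split E G
  ∑split-cong E F≈G = ∑split-congᴵ E (λ S T _ → F≈G S T)

  ∑split-+ : ∀ (E : List X) F G → ∑split E (λ S T → F S T + G S T) ≈ ∑split E F + ∑split E G
  ∑split-+ []      F G = refl
  ∑split-+ (x ∷ E) F G = trans (+-cong (∑split-+ E _ _) (∑split-+ E _ _))
    (solve 4 (λ a b c d → (a :+ b) :+ (c :+ d) := (a :+ c) :+ (b :+ d)) refl _ _ _ _)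

  ∑split-*ˡ : ∀ (E : List X) k F → ∑split E (λ S T → k * F S T) ≈ k * ∑split E F
  ∑split-*ˡ []      k F = refl
  ∑split-*ˡ (x ∷ E) k F = trans (+-cong (∑split-*ˡ E k _) (∑split-*ˡ E k _)) (sym (distribˡ _ _ _))

  ∑split-*ʳ : ∀ (E : List X) k F → ∑split E (λ S T → F S T * k) ≈ ∑split E F * k
  ∑split-*ʳ E k F = trans (∑split-cong E (λ S T → *-comm _ _)) (trans (∑split-*ˡ E k F) (*-comm _ _))

  ∑split-swap : ∀ (E : List X) F → ∑split E F ≈ ∑split E (λ S T → F T S)
  ∑split-swap []      F = refl
  ∑split-swap (x ∷ E) F = trans (+-cong (∑split-swap E _) (∑split-swap E _)) (+-comm _ _)

  ∑split-++ : ∀ (A B : List X) F →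
    ∑split (A ++ B) F ≈ ∑split A (λ S₁ T₁ → ∑split B (λ S₂ T₂ → F (S₁ ++ S₂) (T₁ ++ T₂)))
  ∑split-++ []      B F = refl
  ∑split-++ (x ∷ A) B F = +-cong (∑split-++ A B _) (∑split-++ A B _)

  ∑split-map : ∀ {b} {Y : Set b} (f : Y → X) (E : List Y) F →
    ∑split (map f E) F ≈ ∑split E (λ S T → F (map f S) (map f T))
  ∑split-map f []      F = refl
  ∑split-map f (y ∷ E) F = +-cong (∑split-map f E _) (∑split-map f E _)

  ∑split₃-cong : ∀ (E : List X) {G H} → (∀ U V W → G U V W ≈ H U V W) → ∑split₃ E G ≈ ∑split₃ E H
  ∑split₃-cong []      G≈H = G≈H [] [] []
  ∑split₃-cong (x ∷ E) G≈H = +-cong (∑split₃-cong E (λ _ _ _ → G≈H _ _ _))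
    (+-cong (∑split₃-cong E (λ _ _ _ → G≈H _ _ _)) (∑split₃-cong E (λ _ _ _ → G≈H _ _ _)))

  ∑split₃-swap₁₂ : ∀ (E : List X) G → ∑split₃ E G ≈ ∑split₃ E (λ U V W → G V U W)
  ∑split₃-swap₁₂ []      G = refl
  ∑split₃-swap₁₂ (x ∷ E) G =
    trans (+-cong (∑split₃-swap₁₂ E _) (+-cong (∑split₃-swap₁₂ E _) (∑split₃-swap₁₂ E _)))
      (solve 3 (λ a b c → a :+ (b :+ c) := b :+ (a :+ c)) refl _ _ _)

  ∑split-assocˡ : ∀ (E : List X) G → ∑split E (λ S T → ∑split S (λ U V → G U V T)) ≈ ∑split₃ E G
  ∑split-assocˡ []      G = refl
  ∑split-assocˡ (x ∷ E) G = begin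
    ∑split E (λ S T → ∑split S (λ U V → G (x ∷ U) V T) + ∑split S (λ U V → G U (x ∷ V) T))
      + ∑split E (λ S T → ∑split S (λ U V → G U V (x ∷ T)))
      ≈⟨ +-congʳ (∑split-+ E _ _) ⟩
    (∑split E (λ S T → ∑split S (λ U V → G (x ∷ U) V T))
      + ∑split E (λ S T → ∑split S (λ U V → G U (x ∷ V) T)))
      + ∑split E (λ S T → ∑split S (λ U V → G U V (x ∷ T)))
      ≈⟨ +-cong (+-cong (∑split-assocˡ E _) (∑split-assocˡ E _)) (∑split-assocˡ E _) ⟩
    (∑split₃ E (λ U V W → G (x ∷ U) V W) + ∑split₃ E (λ U V W → G U (x ∷ V) W))
      + ∑split₃ E (λ U V W → G U V (x ∷ W))
      ≈⟨ +-assoc _ _ _ ⟩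
    ∑split₃ (x ∷ E) G ∎

  ∑split-assocʳ : ∀ (E : List X) G → ∑split E (λ S T → ∑split T (λ U V → G S U V)) ≈ ∑split₃ E G
  ∑split-assocʳ []      G = refl
  ∑split-assocʳ (x ∷ E) G = begin
    ∑split E (λ S T → ∑split T (λ U V → G (x ∷ S) U V))
      + ∑split E (λ S T → ∑split T (λ U V → G S (x ∷ U) V) + ∑split T (λ U V → G S U (x ∷ V)))
      ≈⟨ +-congˡ (∑split-+ E _ _) ⟩
    ∑split E (λ S T → ∑split T (λ U V → G (x ∷ S) U V))
      + (∑split E (λ S T → ∑split T (λ U V → G S (x ∷ U) V))
         + ∑split E (λ S T → ∑split T (λ U V → G S U (x ∷ V))))
      ≈⟨ +-cong (∑split-assocʳ E _) (+-cong (∑split-assocʳ E _) (∑split-assocʳ E _)) ⟩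
    ∑split₃ (x ∷ E) G ∎

  ∑-interleaving : ∀ (h : X → Carrier) {S T E} → Interleaving S T E → ∑ S h + ∑ T h ≈ ∑ E h
  ∑-interleaving h []          = +-identityˡ 0#
  ∑-interleaving h (consˡ sp) = trans (+-assoc _ _ _) (+-congˡ (∑-interleaving h sp))
  ∑-interleaving h (consʳ sp) = trans (solve 3 (λ a b c → a :+ (b :+ c) := b :+ (a :+ c)) refl _ _ _)
    (+-congˡ (∑-interleaving h sp))

module FallingFactorials {c ℓ : Level} (R : CommutativeRing c ℓ) where
  open CommutativeRing R
  open import Relation.Binary.Reasoning.Setoid setoid
  open IntegerCoefficientSolver R using (solve; _:+_; _:*_; _:-_; _:=_)
  open ListSums R
  open Splittings R

  -- Unfolds x (x - 1) ⋯ (x - k + 1) from the first factor, whereas Defs' `falling` unfolds from the last.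
  fall : Carrier → ℕ → Carrier
  fall x zero    = 1#
  fall x (suc k) = x * fall (x - 1#) k

  fall-cong : ∀ k {x y} → x ≈ y → fall x k ≈ fall y k
  fall-cong zero    x≈y = refl
  fall-cong (suc k) x≈y = *-cong x≈y (fall-cong k (+-congʳ x≈y))

  module Hurwitz {a} {X : Set a} (h : X → Carrier) where

    fallShifted : List X → Carrier → Carrier
    fallShifted E x = fall (x + ∑ E h) (length E)

    abelFall : List X → Carrier → Carrier
    abelFall []      x = 1#
    abelFall (e ∷ E) x = x * fall (x + ∑ (e ∷ E) h - 1#) (length E)

    HurwitzFor : List X → Set _
    HurwitzFor E = ∀ x y → fallShifted E (x + y) ≈ ∑split E (λ S T → abelFall S x * fallShifted T y)

    fallShifted-cong : ∀ E {x y} → x ≈ y → fallShifted E x ≈ fallShifted E y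
    fallShifted-cong E x≈y = fall-cong (length E) (+-congʳ x≈y)

    fallShifted-∷ : ∀ e E y → fallShifted (e ∷ E) y ≈ (y + ∑ (e ∷ E) h) * fallShifted E (y + (h e - 1#))
    fallShifted-∷ e E y = *-congˡ (fall-cong (length E)
      (solve 4 (λ y u s 1' → (y :+ (u :+ s)) :- 1' := (y :+ (u :- 1')) :+ s) refl y (h e) (∑ E h) 1#))

    abelFall-∷ : ∀ e E x → abelFall (e ∷ E) x ≈ x * fallShifted E (x + (h e - 1#))
    abelFall-∷ e E x = *-congˡ (fall-cong (length E)
      (solve 4 (λ x u s 1' → (x :+ (u :+ s)) :- 1' := (x :+ (u :- 1')) :+ s) refl x (h e) (∑ E h) 1#))

    abelFall-fallShifted : ∀ E x → (x + ∑ E h) * abelFall E x ≈ x * fallShifted E x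
    abelFall-fallShifted []      x = trans (*-identityʳ _) (trans (+-identityʳ x) (sym (*-identityʳ x)))
    abelFall-fallShifted (e ∷ E) x = solve 3 (λ s x f → s :* (x :* f) := x :* (s :* f)) refl _ _ _

    -- Expand the first factor by the identity for S, regroup the three-way splitting and contract
    -- by the identity for the complement.
    convolution-shift : ∀ E → (∀ S → length S ℕ.≤ length E → HurwitzFor S) → ∀ x y →
      ∑split E (λ S T → fallShifted S x * fallShifted T y)
        ≈ ∑split E (λ S T → fallShifted S 0# * fallShifted T (x + y))
    convolution-shift E hurwitz x y = begin
      ∑split E (λ S T → fallShifted S x * fallShifted T y)
        ≈⟨ ∑split-congᴵ E (λ S T sp → *-congʳ (trans (fallShifted-cong S (sym (+-identityʳ x)))
                                                 (hurwitz S (length-interleavingˡ sp) x 0#))) ⟩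
      ∑split E (λ S T → ∑split S (λ U V → abelFall U x * fallShifted V 0#) * fallShifted T y)
        ≈⟨ ∑split-cong E (λ S T → sym (∑split-*ʳ S _ _)) ⟩
      ∑split E (λ S T → ∑split S (λ U V → abelFall U x * fallShifted V 0# * fallShifted T y))
        ≈⟨ ∑split-assocˡ E _ ⟩
      ∑split₃ E (λ U V W → abelFall U x * fallShifted V 0# * fallShifted W y)
        ≈⟨ ∑split₃-swap₁₂ E _ ⟩
      ∑split₃ E (λ U V W → abelFall V x * fallShifted U 0# * fallShifted W y)
        ≈⟨ ∑split₃-cong E (λ U V W → solve 3 (λ a b c → a :* b :* c := b :* (a :* c)) refl _ _ _) ⟩
      ∑split₃ E (λ U V W → fallShifted U 0# * (abelFall V x * fallShifted W y))
        ≈⟨ ∑split-assocʳ E _ ⟨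
      ∑split E (λ S T → ∑split T (λ U V → fallShifted S 0# * (abelFall U x * fallShifted V y)))
        ≈⟨ ∑split-cong E (λ S T → ∑split-*ˡ T _ _) ⟩
      ∑split E (λ S T → fallShifted S 0# * ∑split T (λ U V → abelFall U x * fallShifted V y))
        ≈⟨ ∑split-congᴵ E (λ S T sp → *-congˡ (sym (hurwitz T (length-interleavingʳ sp) x y))) ⟩
      ∑split E (λ S T → fallShifted S 0# * fallShifted T (x + y)) ∎

    weight-split : ∀ e {E S T} → Interleaving S T E → ∀ x y → let β = h e - 1# in
      ((x + y) + ∑ (e ∷ E) h) * (abelFall S x * fallShifted T (y + β))
        ≈ x * (fallShifted S x * fallShifted T (y + β)) + abelFall S x * fallShifted (e ∷ T) y
    weight-split e {E} {S} {T} sp x y = begin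
      ((x + y) + ∑ (e ∷ E) h) * (A * F)
        ≈⟨ *-congʳ (trans (+-congˡ (+-congˡ (sym (∑-interleaving h sp)))) (regroup x y (h e) (∑ S h) (∑ T h))) ⟩
      ((x + ∑ S h) + (y + ∑ (e ∷ T) h)) * (A * F)
        ≈⟨ distribʳ _ _ _ ⟩
      (x + ∑ S h) * (A * F) + (y + ∑ (e ∷ T) h) * (A * F)
        ≈⟨ +-cong (trans (sym (*-assoc _ _ _)) (trans (*-congʳ (abelFall-fallShifted S x)) (*-assoc _ _ _)))
                  (trans (solve 3 (λ u a f → u :* (a :* f) := a :* (u :* f)) refl _ A F)
                         (*-congˡ (sym (fallShifted-∷ e T y)))) ⟩
      x * (fallShifted S x * F) + A * fallShifted (e ∷ T) y ∎
      where
      A = abelFall S x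
      F = fallShifted T (y + (h e - 1#))
      regroup : ∀ x y u s t → (x + y) + (u + (s + t)) ≈ (x + s) + (y + (u + t))
      regroup = solve 5 (λ x y u s t → (x :+ y) :+ (u :+ (s :+ t)) := (x :+ s) :+ (y :+ (u :+ t))) refl

    hurwitz-∷ : ∀ e E → (∀ S → length S ℕ.≤ length E → HurwitzFor S) → HurwitzFor (e ∷ E)
    hurwitz-∷ e E hurwitz x y = begin
      fallShifted (e ∷ E) (x + y)
        ≈⟨ fallShifted-∷ e E (x + y) ⟩
      Z * fallShifted E ((x + y) + β)
        ≈⟨ *-congˡ (trans (fallShifted-cong E (+-assoc x y β)) (hurwitz E ℕ.≤-refl x (y + β))) ⟩
      Z * ∑split E (λ S T → abelFall S x * fallShifted T (y + β))
        ≈⟨ ∑split-*ˡ E Z _ ⟨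
      ∑split E (λ S T → Z * (abelFall S x * fallShifted T (y + β)))
        ≈⟨ ∑split-congᴵ E (λ S T sp → weight-split e sp x y) ⟩
      ∑split E (λ S T → x * (fallShifted S x * fallShifted T (y + β)) + abelFall S x * fallShifted (e ∷ T) y)
        ≈⟨ trans (∑split-+ E _ _) (+-congʳ (∑split-*ˡ E x _)) ⟩
      x * convolution x (y + β) + B
        ≈⟨ +-congʳ (*-congˡ shift-β) ⟩
      x * convolution (x + β) y + B
        ≈⟨ +-congʳ (trans (sym (∑split-*ˡ E x _)) (∑split-cong E (λ S T →
             trans (sym (*-assoc _ _ _)) (*-congʳ (sym (abelFall-∷ e S x)))))) ⟩
      ∑split (e ∷ E) (λ S T → abelFall S x * fallShifted T y) ∎
      where
      β = h e - 1#
      Z = (x + y) + ∑ (e ∷ E) h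
      B = ∑split E (λ S T → abelFall S x * fallShifted (e ∷ T) y)
      convolution : Carrier → Carrier → Carrier
      convolution x′ y′ = ∑split E (λ S T → fallShifted S x′ * fallShifted T y′)
      shift-β : convolution x (y + β) ≈ convolution (x + β) y
      shift-β = begin
        convolution x (y + β)        ≈⟨ convolution-shift E hurwitz x (y + β) ⟩
        convolution 0# (x + (y + β)) ≈⟨ ∑split-cong E (λ S T → *-congˡ (fallShifted-cong T
                                          (solve 3 (λ x y b → x :+ (y :+ b) := (x :+ b) :+ y) refl x y β))) ⟩
        convolution 0# ((x + β) + y) ≈⟨ convolution-shift E hurwitz (x + β) y ⟨
        convolution (x + β) y        ∎

    hurwitz-bounded : ∀ n E → length E ℕ.≤ n → HurwitzFor E
    hurwitz-bounded n       []      _         x y = sym (*-identityˡ 1#)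
    hurwitz-bounded (suc n) (e ∷ E) (s≤s E≤n) =
      hurwitz-∷ e E (λ S S≤E → hurwitz-bounded n S (ℕ.≤-trans S≤E E≤n))

    hurwitz : ∀ E → HurwitzFor E
    hurwitz E = hurwitz-bounded (length E) E ℕ.≤-refl

module SubmultisetSums {c ℓ : Level} (R : CommutativeRing c ℓ) where
  open CommutativeRing R
  open import Relation.Binary.Reasoning.Setoid setoid
  open IntegerCoefficientSolver R using (solve; _:+_; _:*_; _:=_; ι-homo-+; ι-homo-*)
  open ListSums R
  open Splittings R

  ∑<-C-last : ∀ x (f : ℕ → Carrier) →
    ∑< (suc x) (λ i → ι R (x C suc i) * f i) ≈ ∑< x (λ i → ι R (x C suc i) * f i)
  ∑<-C-last x f = begin
    ∑< (suc x) (λ i → ι R (x C suc i) * f i)          ≈⟨ ∑<-suc x _ ⟩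
    ∑< x (λ i → ι R (x C suc i) * f i) + ι R (x C suc x) * f x
      ≈⟨ +-congˡ (trans (*-congʳ (reflexive (≡.cong (ι R) (k>n⇒nCk≡0 (ℕ.n<1+n x))))) (zeroˡ _)) ⟩
    ∑< x (λ i → ι R (x C suc i) * f i) + 0#           ≈⟨ +-identityʳ _ ⟩
    ∑< x (λ i → ι R (x C suc i) * f i)                ∎

  ∑<-pascal : ∀ x (g : ℕ → Carrier) → ∑< (suc (suc x)) (λ i → ι R (suc x C i) * g i)
    ≈ ∑< (suc x) (λ i → ι R (x C i) * g (suc i)) + ∑< (suc x) (λ i → ι R (x C i) * g i)
  ∑<-pascal x g = begin
    ι R (suc x C 0) * g 0 + ∑< (suc x) (λ i → ι R (suc x C suc i) * g (suc i))
      ≈⟨ +-congˡ (∑<-cong (suc x) {λ i → ι R (suc x C suc i) * g (suc i)} (λ i _ → pascal i)) ⟩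
    ι R (suc x C 0) * g 0 + ∑< (suc x) (λ i → shifted i + next i)
      ≈⟨ +-congˡ (trans (∑<-+ (suc x) shifted next) (+-congˡ (∑<-C-last x (g ∘ suc)))) ⟩
    ι R (suc x C 0) * g 0 + (∑< (suc x) shifted + ∑< x next)
      ≈⟨ solve 3 (λ a b c → a :+ (b :+ c) := b :+ (a :+ c)) refl _ _ _ ⟩
    ∑< (suc x) shifted + ∑< (suc x) (λ i → ι R (x C i) * g i) ∎
    where
    shifted next : ℕ → Carrier
    shifted i = ι R (x C i) * g (suc i)
    next    i = ι R (x C suc i) * g (suc i)
    pascal : ∀ i → ι R (suc x C suc i) * g (suc i) ≈ shifted i + next i
    pascal i = trans (*-congʳ (trans (reflexive (≡.cong (ι R) (≡.sym (nCk+nC[k+1]≡[n+1]C[k+1] x i))))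
                                     (ι-homo-+ (x C i) _)))
                     (distribʳ _ _ _)

  ∑split-replicate : ∀ {a} {X : Set a} x (e : X) F →
    ∑split (replicate x e) F ≈ ∑< (suc x) (λ i → ι R (x C i) * F (replicate i e) (replicate (x ∸ i) e))
  ∑split-replicate zero    e F = sym (trans (+-identityʳ _) (trans (*-congʳ (+-identityʳ 1#)) (*-identityˡ _)))
  ∑split-replicate (suc x) e F = begin
    ∑split (replicate x e) (λ S T → F (e ∷ S) T) + ∑split (replicate x e) (λ S T → F S (e ∷ T))
      ≈⟨ +-cong (∑split-replicate x e _) (∑split-replicate x e _) ⟩
    ∑< (suc x) (λ i → ι R (x C i) * g (suc i))
      + ∑< (suc x) (λ i → ι R (x C i) * F (replicate i e) (e ∷ replicate (x ∸ i) e))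
      ≈⟨ +-congˡ (∑<-cong (suc x) {g = λ i → ι R (x C i) * g i} (λ i i<1+x → *-congˡ (reflexive
            (≡.cong (λ j → F (replicate i e) (replicate j e)) (≡.sym (ℕ.+-∸-assoc 1 (ℕ.s≤s⁻¹ i<1+x))))))) ⟩
    ∑< (suc x) (λ i → ι R (x C i) * g (suc i)) + ∑< (suc x) (λ i → ι R (x C i) * g i)
      ≈⟨ ∑<-pascal x g ⟨
    ∑< (suc (suc x)) (λ i → ι R (suc x C i) * g i) ∎
    where
    g : ℕ → Carrier
    g i = F (replicate i e) (replicate (suc x ∸ i) e)

  ∑-boundedVecs-suc : ∀ d b (F : Vec ℕ (suc d) → Carrier) →
    ∑ (boundedVecs (suc d) b) F ≈ ∑< (suc b) (λ x → ∑ (boundedVecs d b) (λ i → F (x ∷ i)))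
  ∑-boundedVecs-suc d b F = begin
    ∑ (boundedVecs (suc d) b) F
      ≈⟨ ∑-concatMap (λ x → map (x ∷_) (boundedVecs d b)) (List.upTo (suc b)) F ⟩
    ∑ (List.upTo (suc b)) (λ x → ∑ (map (x ∷_) (boundedVecs d b)) F)
      ≈⟨ ∑-cong (List.upTo (suc b)) (λ x → reflexive (∑-map (x ∷_) (boundedVecs d b) F)) ⟩
    ∑ (List.upTo (suc b)) (λ x → ∑ (boundedVecs d b) (λ i → F (x ∷ i)))
      ≡⟨ ∑-upTo (suc b) _ ⟩
    ∑< (suc b) (λ x → ∑ (boundedVecs d b) (λ i → F (x ∷ i))) ∎

  ∑-boundedVecs-shrink : ∀ d l K (F : Vec ℕ d → Carrier) → l ℕ.≤ K →
    (∀ i → ¬ VecAll (ℕ._≤ l) i → F i ≈ 0#) → ∑ (boundedVecs d K) F ≈ ∑ (boundedVecs d l) F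
  ∑-boundedVecs-shrink zero    l K F l≤K F≈0 = refl
  ∑-boundedVecs-shrink (suc d) l K F l≤K F≈0 = begin
    ∑ (boundedVecs (suc d) K) F
      ≈⟨ ∑-boundedVecs-suc d K F ⟩
    ∑< (suc K) (λ x → ∑ (boundedVecs d K) (λ i → F (x ∷ i)))
      ≈⟨ ∑<-cong (suc K) (λ x _ → ∑-boundedVecs-shrink d l K (λ i → F (x ∷ i)) l≤K
                                     (λ i i≰l → F≈0 (x ∷ i) (i≰l ∘ VecAll.tail))) ⟩
    ∑< (suc K) (λ x → ∑ (boundedVecs d l) (λ i → F (x ∷ i)))
      ≈⟨ ∑<-truncate l K _ l≤K (λ x l<x → ∑-zero (boundedVecs d l)
                                            (λ i → F≈0 (x ∷ i) (ℕ.<⇒≱ l<x ∘ VecAll.head))) ⟩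
    ∑< (suc l) (λ x → ∑ (boundedVecs d l) (λ i → F (x ∷ i)))
      ≈⟨ ∑-boundedVecs-suc d l F ⟨
    ∑ (boundedVecs (suc d) l) F ∎

  ∑split-consParts : ∀ x P (Φ : ℕ → ℕ → Carrier) →
    ∑split (consParts x P) (λ S T → Φ (length S) (sum S))
      ≈ ∑< (suc x) (λ i → ι R (x C i) * ∑split P (λ S T → Φ (i ℕ.+ length S) (i ℕ.+ (sum S ℕ.+ length S))))
  ∑split-consParts x P Φ = begin
    ∑split (replicate x 1 ++ map suc P) (λ S T → Φ (length S) (sum S))
      ≈⟨ ∑split-++ (replicate x 1) (map suc P) _ ⟩
    ∑split (replicate x 1) (λ S₁ T₁ → ∑split (map suc P) (λ S₂ T₂ → Φ′ (S₁ ++ S₂)))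
      ≈⟨ ∑split-replicate x 1 _ ⟩
    ∑< (suc x) (λ i → ι R (x C i) * ∑split (map suc P) (λ S T → Φ′ (replicate i 1 ++ S)))
      ≈⟨ ∑<-cong (suc x) {g = λ i → ι R (x C i) * shifted i} (λ i _ → *-congˡ (trans
           (∑split-map suc P (λ S T → Φ′ (replicate i 1 ++ S)))
           (∑split-cong P (λ S T → reflexive (≡.cong₂ Φ (length-consParts i S) (sum-consParts i S)))))) ⟩
    ∑< (suc x) (λ i → ι R (x C i) * shifted i) ∎
    where
    Φ′ : List ℕ → Carrier
    Φ′ S = Φ (length S) (sum S)
    shifted : ℕ → Carrier
    shifted i = ∑split P (λ S T → Φ (i ℕ.+ length S) (i ℕ.+ (sum S ℕ.+ length S)))

  -- ∏C v i counts the sub-multisets of parts v made of iⱼ of the vⱼ parts equal to j, for every j.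
  ∑-boundedVecs-parts : ∀ {d} (v : Vec ℕ d) K → VecAll (ℕ._≤ K) v → (Φ : ℕ → ℕ → Carrier) →
    ∑ (boundedVecs d K) (λ i → ι R (∏C v i) * Φ (entrySum i) (weightedSum i))
      ≈ ∑split (parts v) (λ S T → Φ (length S) (sum S))
  ∑-boundedVecs-parts []      K []         Φ =
    trans (+-identityʳ _) (trans (*-congʳ (+-identityʳ 1#)) (*-identityˡ _))
  ∑-boundedVecs-parts {suc d} (x ∷ v) K (x≤K ∷ v≤K) Φ = begin
    ∑ (boundedVecs (suc d) K) weighted
      ≈⟨ ∑-boundedVecs-suc d K weighted ⟩
    ∑< (suc K) (λ j → ∑ (boundedVecs d K) (λ i → weighted (j ∷ i)))
      ≈⟨ ∑<-cong (suc K) {g = λ j → ι R (x C j) * tailSum j}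
           (λ j _ → trans (∑-cong (boundedVecs d K) (peel-head j)) (∑-*ˡ (boundedVecs d K) _ _)) ⟩
    ∑< (suc K) (λ j → ι R (x C j) * tailSum j)
      ≈⟨ ∑<-cong (suc K) {g = λ j → ι R (x C j) * tailSplit j}
           (λ j _ → *-congˡ (∑-boundedVecs-parts v K v≤K (Φ′ j))) ⟩
    ∑< (suc K) (λ j → ι R (x C j) * tailSplit j)
      ≈⟨ ∑<-truncate x K (λ j → ι R (x C j) * tailSplit j) x≤K
           (λ j x<j → trans (*-congʳ (reflexive (≡.cong (ι R) (k>n⇒nCk≡0 x<j)))) (zeroˡ _)) ⟩
    ∑< (suc x) (λ j → ι R (x C j) * tailSplit j)
      ≈⟨ ∑split-consParts x (parts v) Φ ⟨
    ∑split (parts (x ∷ v)) (λ S T → Φ (length S) (sum S)) ∎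
    where
    weighted : Vec ℕ (suc d) → Carrier
    weighted i = ι R (∏C (x ∷ v) i) * Φ (entrySum i) (weightedSum i)
    Φ′ : ℕ → ℕ → ℕ → Carrier
    Φ′ j l m = Φ (j ℕ.+ l) (j ℕ.+ (m ℕ.+ l))
    tailSum : ℕ → Carrier
    tailSum j = ∑ (boundedVecs d K) (λ i → ι R (∏C v i) * Φ′ j (entrySum i) (weightedSum i))
    tailSplit : ℕ → Carrier
    tailSplit j = ∑split (parts v) (λ S T → Φ′ j (length S) (sum S))
    peel-head : ∀ j i → weighted (j ∷ i) ≈ ι R (x C j) * (ι R (∏C v i) * Φ′ j (entrySum i) (weightedSum i))
    peel-head j i = trans (*-cong (ι-homo-* (x C j) (∏C v i))
                                  (reflexive (≡.cong (Φ (j ℕ.+ entrySum i)) (weightedSum-∷ j i))))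
                          (*-assoc _ _ _)

  hasShape : ∀ {d} → ℕ → ℕ → Vec ℕ d → Bool
  hasShape l m i = does (entrySum i ℕ.≟ l) ∧ does (weightedSum i ℕ.≟ m)

  ι-W : ∀ {d} (v : Vec ℕ d) k l m → l ℕ.≤ k →
    ι R (W m l v) ≈ ∑ (boundedVecs d k) (λ i → 𝟙 (hasShape l m i) * ι R (∏C v i))
  ι-W {d} v k l m l≤k = begin
    ι R (W m l v)
      ≈⟨ ι-sum-filter (λ i → (entrySum i ℕ.≟ l) ×-dec (weightedSum i ℕ.≟ m)) (∏C v) (boundedVecs d l) ⟩
    ∑ (boundedVecs d l) shaped
      ≈⟨ ∑-boundedVecs-shrink d l k shaped l≤k
           (λ i i≰l → trans (*-congʳ (reflexive (≡.cong 𝟙 (no-shape i i≰l)))) (zeroˡ _)) ⟨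
    ∑ (boundedVecs d k) shaped ∎
    where
    shaped : Vec ℕ d → Carrier
    shaped i = 𝟙 (hasShape l m i) * ι R (∏C v i)
    no-shape : ∀ i → ¬ VecAll (ℕ._≤ l) i → hasShape l m i ≡ false
    no-shape i i≰l = ≡.cong (_∧ does (weightedSum i ℕ.≟ m)) (dec-false (entrySum i ℕ.≟ l)
      (λ i≡l → i≰l (≡.subst (λ s → VecAll (ℕ._≤ s) i) i≡l (entries≤entrySum i))))

  ∑range-indicator : ∀ k n (G : ℕ → ℕ → Carrier) {l₀ m₀} → l₀ ℕ.≤ k → l₀ ℕ.≤ m₀ → m₀ ℕ.≤ n →
    ∑range 0 k (λ l → ∑range l n (λ m → 𝟙 (does (l₀ ℕ.≟ l) ∧ does (m₀ ℕ.≟ m)) * G l m)) ≈ G l₀ m₀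
  ∑range-indicator k n G {l₀} {m₀} l₀≤k l₀≤m₀ m₀≤n = begin
    ∑range 0 k (λ l → ∑range l n (λ m → 𝟙 (does (l₀ ℕ.≟ l) ∧ does (m₀ ℕ.≟ m)) * G l m))
      ≈⟨ ∑range-cong 0 k (λ l _ _ → trans (∑range-cong l n (λ m _ _ → split-𝟙 l m)) (∑range-*ˡ l n _ _)) ⟩
    ∑range 0 k (λ l → 𝟙 (does (l₀ ℕ.≟ l)) * ∑range l n (λ m → 𝟙 (does (m₀ ℕ.≟ m)) * G l m))
      ≈⟨ ∑range-δ 0 k l₀ _ z≤n l₀≤k ⟩
    ∑range l₀ n (λ m → 𝟙 (does (m₀ ℕ.≟ m)) * G l₀ m)
      ≈⟨ ∑range-δ l₀ n m₀ _ l₀≤m₀ m₀≤n ⟩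
    G l₀ m₀ ∎
    where
    split-𝟙 : ∀ l m → 𝟙 (does (l₀ ℕ.≟ l) ∧ does (m₀ ℕ.≟ m)) * G l m
                    ≈ 𝟙 (does (l₀ ℕ.≟ l)) * (𝟙 (does (m₀ ℕ.≟ m)) * G l m)
    split-𝟙 l m = trans (*-congʳ (𝟙-∧ (does (l₀ ℕ.≟ l)) (does (m₀ ℕ.≟ m)))) (*-assoc _ _ _)

  ∑range-hasShape : ∀ {d} (v i : Vec ℕ d) {k n} → entrySum v ≡ k → weightedSum v ≡ n →
    (G : ℕ → ℕ → Carrier) →
    ∑range 0 k (λ l → ∑range l n (λ m → ι R (∏C v i) * (𝟙 (hasShape l m i) * G l m)))
      ≈ ι R (∏C v i) * G (entrySum i) (weightedSum i)
  ∑range-hasShape v i {k} {n} v≡k v≡n G =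
    trans (trans (∑range-cong 0 k (λ l _ _ → ∑range-*ˡ l n _ _)) (∑range-*ˡ 0 k _ _))
          (by-cases (Pointwise.decidable ℕ._≤?_ i v))
    where
    by-cases : Dec (Pointwise ℕ._≤_ i v) →
      ι R (∏C v i) * ∑range 0 k (λ l → ∑range l n (λ m → 𝟙 (hasShape l m i) * G l m))
        ≈ ι R (∏C v i) * G (entrySum i) (weightedSum i)
    by-cases (yes i≤v) = *-congˡ (∑range-indicator k n G
      (≡.subst (entrySum i ℕ.≤_) v≡k (entrySum-mono-≤ i≤v))
      (entrySum≤weightedSum i)
      (≡.subst (weightedSum i ℕ.≤_) v≡n (weightedSum-mono-≤ i≤v)))
    by-cases (no i≰v) = trans (*-congʳ ∏C≈0) (trans (zeroˡ _) (sym (trans (*-congʳ ∏C≈0) (zeroˡ _))))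
      where
      ∏C≈0 : ι R (∏C v i) ≈ 0#
      ∏C≈0 = reflexive (≡.cong (ι R) (∏C-≰ v i i≰v))

  ∑range-W : ∀ {d} (v : Vec ℕ d) {k n} → entrySum v ≡ k → weightedSum v ≡ n →
    (G : ℕ → ℕ → Carrier) →
    ∑range 0 k (λ l → ∑range l n (λ m → G l m * ι R (W m l v)))
      ≈ ∑split (parts v) (λ S T → G (length S) (sum S))
  ∑range-W {d} v {k} {n} v≡k v≡n G = begin
    ∑range 0 k (λ l → ∑range l n (λ m → G l m * ι R (W m l v)))
      ≈⟨ ∑range-cong 0 k (λ l _ l≤k → ∑range-cong l n (λ m _ _ → expand l m l≤k)) ⟩
    ∑range 0 k (λ l → ∑range l n (λ m → ∑ B (term l m)))
      ≈⟨ ∑range-cong 0 k (λ l _ _ → ∑range-comm l n B (term l)) ⟩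
    ∑range 0 k (λ l → ∑ B (λ i → ∑range l n (λ m → term l m i)))
      ≈⟨ ∑range-comm 0 k B (λ l i → ∑range l n (λ m → term l m i)) ⟩
    ∑ B (λ i → ∑range 0 k (λ l → ∑range l n (λ m → term l m i)))
      ≈⟨ ∑-cong B (λ i → ∑range-hasShape v i v≡k v≡n G) ⟩
    ∑ B (λ i → ι R (∏C v i) * G (entrySum i) (weightedSum i))
      ≈⟨ ∑-boundedVecs-parts v k (≡.subst (λ s → VecAll (ℕ._≤ s) v) v≡k (entries≤entrySum v)) G ⟩
    ∑split (parts v) (λ S T → G (length S) (sum S)) ∎
    where
    B = boundedVecs d k
    term : ℕ → ℕ → Vec ℕ d → Carrier
    term l m i = ι R (∏C v i) * (𝟙 (hasShape l m i) * G l m)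
    expand : ∀ l m → l ℕ.≤ k → G l m * ι R (W m l v) ≈ ∑ B (term l m)
    expand l m l≤k = begin
      G l m * ι R (W m l v)                               ≈⟨ *-congˡ (ι-W v k l m l≤k) ⟩
      G l m * ∑ B (λ i → 𝟙 (hasShape l m i) * ι R (∏C v i)) ≈⟨ ∑-*ˡ B _ _ ⟨
      ∑ B (λ i → G l m * (𝟙 (hasShape l m i) * ι R (∏C v i)))
        ≈⟨ ∑-cong B (λ i → solve 3 (λ g b p → g :* (b :* p) := p :* (b :* g)) refl _ _ _) ⟩
      ∑ B (term l m)                                      ∎

module FieldFacts {r ℓ : Level} (R : CommutativeRing r ℓ) (F : IsCharZeroField R) where
  open CommutativeRing R
  open FieldOps R F
  open import Relation.Binary.Reasoning.Setoid setoid
  open IntegerCoefficientSolver R using (solve; _:+_; _:*_; _:-_; _:=_; ι-homo-*)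
  open ListSums R using (∑)
  open Splittings R using (∑split; ∑split-congᴵ)
  open FallingFactorials R using (fall; fall-cong; module Hurwitz)
  open import Algebra.Properties.Ring ring using (-0#≈0#)

  ≉0-*ˡ : ∀ {x y} → ¬ x * y ≈ 0# → ¬ x ≈ 0#
  ≉0-*ˡ xy≉0 x≈0 = xy≉0 (trans (*-congʳ x≈0) (zeroˡ _))

  ⁻¹-unique : ∀ {x y} → ¬ x ≈ 0# → x * y ≈ 1# → y ≈ x ⁻¹
  ⁻¹-unique {x} {y} x≉0 xy≈1 = begin
    y                ≈⟨ *-identityʳ y ⟨
    y * 1#           ≈⟨ *-congˡ (⁻¹-inverse x x≉0) ⟨
    y * (x * x ⁻¹)   ≈⟨ *-assoc _ _ _ ⟨
    (y * x) * x ⁻¹   ≈⟨ *-congʳ (trans (*-comm y x) xy≈1) ⟩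
    1# * x ⁻¹        ≈⟨ *-identityˡ _ ⟩
    x ⁻¹             ∎

  ⁻¹-cong : ∀ {x y} → ¬ x ≈ 0# → x ≈ y → x ⁻¹ ≈ y ⁻¹
  ⁻¹-cong x≉0 x≈y = ⁻¹-unique (x≉0 ∘ trans x≈y) (trans (*-congʳ (sym x≈y)) (⁻¹-inverse _ x≉0))

  ⁻¹-distrib-* : ∀ {x y} → ¬ x * y ≈ 0# → x ⁻¹ * y ⁻¹ ≈ (x * y) ⁻¹
  ⁻¹-distrib-* {x} {y} xy≉0 = ⁻¹-unique xy≉0 (begin
    (x * y) * (x ⁻¹ * y ⁻¹)
      ≈⟨ solve 4 (λ x y x' y' → (x :* y) :* (x' :* y') := (x :* x') :* (y :* y')) refl x y (x ⁻¹) (y ⁻¹) ⟩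
    (x * x ⁻¹) * (y * y ⁻¹)
      ≈⟨ *-cong (⁻¹-inverse x (≉0-*ˡ xy≉0)) (⁻¹-inverse y (≉0-*ˡ (xy≉0 ∘ trans (*-comm x y)))) ⟩
    1# * 1#                    ≈⟨ *-identityʳ 1# ⟩
    1#                         ∎)

  ι-≉0 : ∀ n → .{{ℕ.NonZero n}} → ¬ ι R n ≈ 0#
  ι-≉0 (suc n) = charZero n

  factorials⁻¹ : ∀ {k l} → l ℕ.≤ k →
    ι R ((k ∸ l) !) ⁻¹ * ι R (l !) ⁻¹ * ι R (k C l) ⁻¹ ≈ ι R (k !) ⁻¹
  factorials⁻¹ {k} {l} l≤k = begin
    a ⁻¹ * b ⁻¹ * c ⁻¹       ≈⟨ *-congʳ (⁻¹-distrib-* (≉0-*ˡ abc≉0)) ⟩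
    (a * b) ⁻¹ * c ⁻¹        ≈⟨ ⁻¹-distrib-* abc≉0 ⟩
    (a * b * c) ⁻¹           ≈⟨ ⁻¹-cong abc≉0 abc≈k! ⟩
    ι R (k !) ⁻¹             ∎
    where
    a = ι R ((k ∸ l) !)
    b = ι R (l !)
    c = ι R (k C l)
    abc≈k! : a * b * c ≈ ι R (k !)
    abc≈k! = begin
      a * b * c                               ≈⟨ solve 3 (λ a b c → a :* b :* c := c :* (b :* a)) refl a b c ⟩
      c * (b * a)                             ≈⟨ trans (ι-homo-* (k C l) _) (*-congˡ (ι-homo-* (l !) ((k ∸ l) !))) ⟨
      ι R ((k C l) ℕ.* (l ! ℕ.* (k ∸ l) !))   ≡⟨ ≡.cong (ι R) (C*factorials≡! l≤k) ⟩
      ι R (k !)                               ∎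
    abc≉0 : ¬ a * b * c ≈ 0#
    abc≉0 = ι-≉0 (k !) {{k ℕ.!≢0}} ∘ trans (sym abc≈k!)

  binom-ratio : ∀ {k l} (x a u w : Carrier) → l ℕ.≤ k →
    (x / a) * ((binom u (k ∸ l) * binom w l) / ι R (k C l))
      ≈ (x * a ⁻¹) * (falling u (k ∸ l) * falling w l) * ι R (k !) ⁻¹
  binom-ratio {k} {l} x a u w l≤k = begin
    (x * a ⁻¹) * ((u′ * ι R ((k ∸ l) !) ⁻¹ * (w′ * ι R (l !) ⁻¹)) * ι R (k C l) ⁻¹)
      ≈⟨ solve 6 (λ y u w a b c → y :* ((u :* a :* (w :* b)) :* c) := y :* (u :* w) :* (a :* b :* c)) refl
           (x * a ⁻¹) u′ w′ (ι R ((k ∸ l) !) ⁻¹) (ι R (l !) ⁻¹) (ι R (k C l) ⁻¹) ⟩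
    (x * a ⁻¹) * (u′ * w′) * (ι R ((k ∸ l) !) ⁻¹ * ι R (l !) ⁻¹ * ι R (k C l) ⁻¹)
      ≈⟨ *-congˡ (factorials⁻¹ l≤k) ⟩
    (x * a ⁻¹) * (u′ * w′) * ι R (k !) ⁻¹ ∎
    where
    u′ = falling u (k ∸ l)
    w′ = falling w l

  falling≈fall : ∀ x k → falling x k ≈ fall x k
  falling≈fall x zero    = refl
  falling≈fall x (suc k) = trans (*-congʳ (falling≈fall x k)) (sym (fall-last x k))
    where
    fall-last : ∀ x k → fall x (suc k) ≈ fall x k * (x - ι R k)
    fall-last x zero    = trans (*-identityʳ x) (sym (trans (*-identityˡ _) (trans (+-congˡ -0#≈0#) (+-identityʳ x))))
    fall-last x (suc k) = begin
      x * fall (x - 1#) (suc k)                    ≈⟨ *-congˡ (fall-last (x - 1#) k) ⟩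
      x * (fall (x - 1#) k * ((x - 1#) - ι R k))   ≈⟨ *-assoc _ _ _ ⟨
      (x * fall (x - 1#) k) * ((x - 1#) - ι R k)
        ≈⟨ *-congˡ (solve 3 (λ x o i → (x :- o) :- i := x :- (o :+ i)) refl x 1# (ι R k)) ⟩
      (x * fall (x - 1#) k) * (x - ι R (suc k))    ∎

  module _ {a} {X : Set a} (h : X → Carrier) where
    open Hurwitz h

    abelFall-÷ : ∀ S x {α} → ¬ α ≈ 0# → α ≈ x + ∑ S h → abelFall S x ≈ (x * α ⁻¹) * fall α (length S)
    abelFall-÷ []      x {α} α≉0 α≈x = begin
      1#                ≈⟨ ⁻¹-inverse α α≉0 ⟨
      α * α ⁻¹          ≈⟨ *-congʳ (trans α≈x (+-identityʳ x)) ⟩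
      x * α ⁻¹          ≈⟨ *-identityʳ _ ⟨
      (x * α ⁻¹) * 1#   ∎
    abelFall-÷ (e ∷ S) x {α} α≉0 α≈x+S = begin
      x * fall (x + ∑ (e ∷ S) h - 1#) (length S)     ≈⟨ *-congˡ (fall-cong (length S) (+-congʳ (sym α≈x+S))) ⟩
      x * fall (α - 1#) (length S)                   ≈⟨ *-congʳ (trans (*-congˡ (⁻¹-inverse α α≉0)) (*-identityʳ x)) ⟨
      (x * (α * α ⁻¹)) * fall (α - 1#) (length S)
        ≈⟨ solve 4 (λ x a a' f → (x :* (a :* a')) :* f := (x :* a') :* (a :* f)) refl x α (α ⁻¹) _ ⟩
      (x * α ⁻¹) * (α * fall (α - 1#) (length S))    ∎

    hurwitz-÷ : ∀ E x y (α β : List X → List X → Carrier) →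
      (∀ S T → Interleaving S T E → ¬ α S T ≈ 0# × α S T ≈ x + ∑ S h × β S T ≈ y + ∑ T h) →
      ∑split E (λ S T → (x * α S T ⁻¹) * fall (α S T) (length S) * fall (β S T) (length T))
        ≈ fall ((x + y) + ∑ E h) (length E)
    hurwitz-÷ E x y α β hyp = begin
      ∑split E (λ S T → (x * α S T ⁻¹) * fall (α S T) (length S) * fall (β S T) (length T))
        ≈⟨ ∑split-congᴵ E (λ S T sp → let (α≉0 , α≈x+S , β≈y+T) = hyp S T sp in
             *-cong (sym (abelFall-÷ S x α≉0 α≈x+S)) (fall-cong (length T) β≈y+T)) ⟩
      ∑split E (λ S T → abelFall S x * fallShifted T y)
        ≈⟨ hurwitz E x y ⟨
      fallShifted E (x + y) ∎

module Identities {r ℓ : Level} (R : CommutativeRing r ℓ) (F : IsCharZeroField R)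
  {d : ℕ} (v : Vec ℕ d) {k n : ℕ} (v≡k : entrySum v ≡ k) (v≡n : weightedSum v ≡ n)
  (a₀ a₁ a₂ τ : CommutativeRing.Carrier R) where

  open CommutativeRing R
  open FieldOps R F
  open import Relation.Binary.Reasoning.Setoid setoid
  open IntegerCoefficientSolver R using (solve; _:+_; _:*_; _:-_; :-_; _:=_; ι-homo-+)
  open ListSums R
  open Splittings R
  open FallingFactorials R using (fall; fall-cong)
  open SubmultisetSums R using (∑range-W)
  open FieldFacts R F

  α : ℕ → ℕ → Carrier
  α l m = a₀ + a₁ * ι R l + a₂ * ι R m

  weight : ℕ → Carrier
  weight w = a₁ + a₂ * ι R w

  α-parts : ∀ S → α (length S) (sum S) ≈ a₀ + ∑ S weight
  α-parts S = trans (+-assoc _ _ _) (+-congˡ (sym (∑-weight S)))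
    where
    ∑-weight : ∀ S → ∑ S weight ≈ a₁ * ι R (length S) + a₂ * ι R (sum S)
    ∑-weight []      = sym (trans (+-cong (zeroʳ a₁) (zeroʳ a₂)) (+-identityʳ 0#))
    ∑-weight (w ∷ S) = begin
      weight w + ∑ S weight
        ≈⟨ +-congˡ (∑-weight S) ⟩
      (a₁ + a₂ * ι R w) + (a₁ * ι R (length S) + a₂ * ι R (sum S))
        ≈⟨ solve 5 (λ a b w l s → (a :+ b :* w) :+ (a :* l :+ b :* s) := (a :+ a :* l) :+ b :* (w :+ s))
                   refl a₁ a₂ (ι R w) (ι R (length S)) (ι R (sum S)) ⟩
      (a₁ + a₁ * ι R (length S)) + a₂ * (ι R w + ι R (sum S))
        ≈⟨ +-cong (trans (+-congʳ (sym (*-identityʳ a₁))) (sym (distribˡ a₁ 1# _)))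
                  (*-congˡ (sym (ι-homo-+ w (sum S)))) ⟩
      a₁ * ι R (length (w ∷ S)) + a₂ * ι R (sum (w ∷ S)) ∎

  module _ (α≉0 : ∀ l m → l ℕ.≤ k → l ℕ.≤ m → m ℕ.≤ n → ¬ α l m ≈ 0#) where

    P : List ℕ
    P = parts v

    αₚ : List ℕ → Carrier
    αₚ S = α (length S) (sum S)

    k!⁻¹ : Carrier
    k!⁻¹ = ι R (k !) ⁻¹

    length-P : length P ≡ k
    length-P = ≡.trans (length-parts v) v≡k

    module _ {S T : List ℕ} (sp : Interleaving S T P) where

      αₚ≉0 : ¬ αₚ S ≈ 0#
      αₚ≉0 = α≉0 (length S) (sum S) (≡.subst (length S ℕ.≤_) v≡k (sublist-length≤entrySum v sp))
                 (sublist-length≤sum v sp) (≡.subst (sum S ℕ.≤_) v≡n (sublist-sum≤weightedSum v sp))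

      length-T : k ∸ length S ≡ length T
      length-T = ≡.sym (≡.trans (complement-length v sp) (≡.cong (_∸ length S) v≡k))

      ∑-P : ∑ P weight ≈ ∑ S weight + ∑ T weight
      ∑-P = sym (∑-interleaving weight sp)

      binom-pair : ∀ {x x′} → x ≈ x′ → ∀ u w →
        (x / αₚ S) * ((binom u (k ∸ length S) * binom w (length S)) / ι R (k C length S))
          ≈ (x′ * αₚ S ⁻¹) * fall w (length S) * fall u (length T) * k!⁻¹
      binom-pair {x} {x′} x≈x′ u w = begin
        (x / αₚ S) * ((binom u (k ∸ length S) * binom w (length S)) / ι R (k C length S))
          ≈⟨ binom-ratio x (αₚ S) u w (≡.subst (length S ℕ.≤_) v≡k (sublist-length≤entrySum v sp)) ⟩
        (x * αₚ S ⁻¹) * (falling u (k ∸ length S) * falling w (length S)) * k!⁻¹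
          ≈⟨ *-congʳ (*-cong (*-congʳ x≈x′) (*-cong falling-u (falling≈fall w (length S)))) ⟩
        (x′ * αₚ S ⁻¹) * (fall u (length T) * fall w (length S)) * k!⁻¹
          ≈⟨ *-congʳ (solve 3 (λ c u w → c :* (u :* w) := c :* w :* u) refl _ _ _) ⟩
        (x′ * αₚ S ⁻¹) * fall w (length S) * fall u (length T) * k!⁻¹ ∎
        where
        falling-u : falling u (k ∸ length S) ≈ fall u (length T)
        falling-u = trans (falling≈fall u (k ∸ length S)) (reflexive (≡.cong (fall u) length-T))

    binom-τ : ∀ {z} → z ≈ τ → fall z (length P) * k!⁻¹ ≈ binom τ k
    binom-τ z≈τ = *-congʳ (trans (fall-cong (length P) z≈τ)
      (trans (reflexive (≡.cong (fall τ) length-P)) (sym (falling≈fall τ k))))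

    identity-α00 :
      ∑range 0 k (λ l → ∑range l n (λ m →
        (α 0 0 / α l m) * ((binom (τ - α l m) (k ∸ l) * binom (α l m) l) / ι R (k C l)) * ι R (W m l v)))
      ≈ binom τ k
    identity-α00 = begin
      _ ≈⟨ ∑range-W v v≡k v≡n G ⟩
      ∑split P (λ S T → G (length S) (sum S))
        ≈⟨ ∑split-congᴵ P (λ S T sp → binom-pair sp α00≈a₀ (τ - αₚ S) (αₚ S)) ⟩
      ∑split P (λ S T → (a₀ * αₚ S ⁻¹) * fall (αₚ S) (length S) * fall (τ - αₚ S) (length T) * k!⁻¹)
        ≈⟨ ∑split-*ʳ P k!⁻¹ _ ⟩
      ∑split P (λ S T → (a₀ * αₚ S ⁻¹) * fall (αₚ S) (length S) * fall (τ - αₚ S) (length T)) * k!⁻¹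
        ≈⟨ *-congʳ (hurwitz-÷ weight P a₀ y (λ S _ → αₚ S) (λ S _ → τ - αₚ S)
                      (λ S T sp → αₚ≉0 sp , α-parts S , τ-αₚ≈ sp)) ⟩
      fall ((a₀ + y) + ∑ P weight) (length P) * k!⁻¹
        ≈⟨ binom-τ (solve 3 (λ a t s → (a :+ (t :- (a :+ s))) :+ s := t) refl a₀ τ (∑ P weight)) ⟩
      binom τ k ∎
      where
      G : ℕ → ℕ → Carrier
      G l m = (α 0 0 / α l m) * ((binom (τ - α l m) (k ∸ l) * binom (α l m) l) / ι R (k C l))
      y = τ - (a₀ + ∑ P weight)
      α00≈a₀ : α 0 0 ≈ a₀
      α00≈a₀ = trans (+-cong (trans (+-congˡ (zeroʳ a₁)) (+-identityʳ a₀)) (zeroʳ a₂)) (+-identityʳ a₀)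
      τ-αₚ≈ : ∀ {S T} → Interleaving S T P → τ - αₚ S ≈ y + ∑ T weight
      τ-αₚ≈ {S} {T} sp = begin
        τ - αₚ S
          ≈⟨ +-congˡ (-‿cong (α-parts S)) ⟩
        τ - (a₀ + ∑ S weight)
          ≈⟨ solve 4 (λ t a s u → t :- (a :+ s) := (t :- (a :+ (s :+ u))) :+ u) refl τ a₀ (∑ S weight) (∑ T weight) ⟩
        (τ - (a₀ + (∑ S weight + ∑ T weight))) + ∑ T weight
          ≈⟨ +-congʳ (+-congˡ (-‿cong (+-congˡ (∑-P sp)))) ⟨
        y + ∑ T weight ∎

    identity-αkn :
      ∑range 0 k (λ l → ∑range l n (λ m →
        (α k n / α l m) * ((binom (α l m) (k ∸ l) * binom (τ - α l m) l) / ι R (k C l)) * ι R (W m l v)))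
      ≈ binom τ k
    identity-αkn = begin
      _ ≈⟨ ∑range-W v v≡k v≡n G ⟩
      ∑split P (λ S T → G (length S) (sum S))
        ≈⟨ ∑split-congᴵ P (λ S T sp → binom-pair sp αkn≈A (αₚ S) (τ - αₚ S)) ⟩
      ∑split P (λ S T → (A * αₚ S ⁻¹) * fall (τ - αₚ S) (length S) * fall (αₚ S) (length T) * k!⁻¹)
        ≈⟨ ∑split-swap P _ ⟩
      ∑split P (λ U V → (A * αₚ V ⁻¹) * fall (τ - αₚ V) (length V) * fall (αₚ V) (length U) * k!⁻¹)
        ≈⟨ ∑split-cong P (λ U V → *-congʳ (solve 3 (λ c f g → c :* f :* g := c :* g :* f) refl _ _ _)) ⟩
      ∑split P (λ U V → (A * αₚ V ⁻¹) * fall (αₚ V) (length U) * fall (τ - αₚ V) (length V) * k!⁻¹)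
        ≈⟨ ∑split-*ʳ P k!⁻¹ _ ⟩
      ∑split P (λ U V → (A * αₚ V ⁻¹) * fall (αₚ V) (length U) * fall (τ - αₚ V) (length V)) * k!⁻¹
        ≈⟨ *-congʳ (hurwitz-÷ −weight P A y (λ _ V → αₚ V) (λ _ V → τ - αₚ V)
                      (λ U V sp → αₚ≉0 (interleaving-swap sp) , αₚ≈ sp , τ-αₚ≈ V)) ⟩
      fall ((A + y) + ∑ P −weight) (length P) * k!⁻¹
        ≈⟨ binom-τ (trans (+-congˡ (∑-neg P weight))
             (solve 3 (λ a t s → ((a :+ s) :+ (t :- a)) :+ (:- s) := t) refl a₀ τ (∑ P weight))) ⟩
      binom τ k ∎
      where
      G : ℕ → ℕ → Carrier
      G l m = (α k n / α l m) * ((binom (α l m) (k ∸ l) * binom (τ - α l m) l) / ι R (k C l))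
      A = a₀ + ∑ P weight
      y = τ - a₀
      −weight : ℕ → Carrier
      −weight w = - weight w
      αkn≈A : α k n ≈ A
      αkn≈A = trans (reflexive (≡.cong₂ α (≡.sym length-P) (≡.sym (≡.trans (sum-parts v) v≡n)))) (α-parts P)
      αₚ≈ : ∀ {U V} → Interleaving U V P → αₚ V ≈ A + ∑ U −weight
      αₚ≈ {U} {V} sp = begin
        αₚ V
          ≈⟨ α-parts V ⟩
        a₀ + ∑ V weight
          ≈⟨ solve 3 (λ a u w → a :+ w := (a :+ (w :+ u)) :+ (:- u)) refl a₀ (∑ U weight) (∑ V weight) ⟩
        (a₀ + (∑ V weight + ∑ U weight)) + - ∑ U weight
          ≈⟨ +-cong (+-congˡ (∑-P (interleaving-swap sp))) (∑-neg U weight) ⟨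
        A + ∑ U −weight ∎
      τ-αₚ≈ : ∀ V → τ - αₚ V ≈ y + ∑ V −weight
      τ-αₚ≈ V = begin
        τ - αₚ V                ≈⟨ +-congˡ (-‿cong (α-parts V)) ⟩
        τ - (a₀ + ∑ V weight)   ≈⟨ solve 3 (λ t a s → t :- (a :+ s) := (t :- a) :+ (:- s)) refl τ a₀ (∑ V weight) ⟩
        y + - ∑ V weight        ≈⟨ +-congˡ (∑-neg V weight) ⟨
        y + ∑ V −weight         ∎

theorem2p2 : ∀ {c ℓ' : Level} (R : CommutativeRing c ℓ') (F : IsCharZeroField R) →
    let open CommutativeRing R
        open FieldOps R F
    in (d : ℕ) (v : Vec ℕ d) (k n : ℕ) →
       entrySum v ≡ k → 0 ℕ.< k → weightedSum v ≡ n →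
       (a₀ a₁ a₂ : Carrier) →
       let α : ℕ → ℕ → Carrier
           α l m = a₀ + a₁ * ι R l + a₂ * ι R m
       in (∀ l m → l ℕ.≤ k → l ℕ.≤ m → m ℕ.≤ n → ¬ (α l m ≈ 0#)) →
          (τ : Carrier) →
          (sumFromTo 0 k (λ l → sumFromTo l n (λ m →
              (α k n / α l m)
              * ((binom (α l m) (k ∸ l) * binom (τ - α l m) l) / ι R (k C l))
              * ι R (W m l v)))
            ≈ binom τ k)
          ×
          (sumFromTo 0 k (λ l → sumFromTo l n (λ m →
              (α 0 0 / α l m)
              * ((binom (τ - α l m) (k ∸ l) * binom (α l m) l) / ι R (k C l))
              * ι R (W m l v)))
            ≈ binom τ k)
-- The identities hold for k = 0 as well.
theorem2p2 R F d v k n v≡k _ v≡n a₀ a₁ a₂ α≉0 τ = identity-αkn α≉0 , identity-α00 α≉0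
  where open Identities R F v v≡k v≡n a₀ a₁ a₂ τ
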